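{- Let $(G_1,G_2,S)$ be a constrained alignment instance with $m_2=1$ and $m_1$ a positive integer. Then every clique in the conflict graph $\mathcal{C}$ has at most $m_1^2$ vertices.
   Context: Let $G_1=(V_1,E_1)$ and $G_2=(V_2,E_2)$ be finite simple undirected graphs with $V_1\cap V_2=\emptyset$, and let $S$ be a bipartite graph with parts $V_1,V_2$ in which every vertex of $V_1$ has degree at most $m_1$ and every vertex of $V_2$ has degree at most $m_2$; edges of $S$ are similarity edges. A $c_4$ is a 4-cycle $a-b-c-d-a$ in $G_1\cup G_2\cup S$ with $a,b\in V_1$, $c,d\in V_2$, $ab\in E_1$, $cd\in E_2$, $ad,bc\in E(S)$, regarded as a subgraph. Two distinct $c_4$s conflict if their similarity edges cannot all belong to a common matching of $S$. The conflict graph $\mathcal{C}$ has one vertex per $c_4$ and an edge between each pair of conflicting $c_4$s. -}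

module Defs where

open import Data.Bool using (Bool; true; false)
open import Data.Nat using (ℕ; _≤_; _*_)
open import Data.Fin using (Fin)
open import Data.List using (List; []; _∷_; length; filterᵇ)
open import Data.List.Membership.Propositional using (_∈_)
open import Data.List.Relation.Unary.All using (All)
open import Data.List.Relation.Unary.AllPairs using (AllPairs)
open import Data.Product using (Σ; _×_; _,_; proj₁; proj₂)
open import Data.Sum using (_⊎_)
open import Relation.Nullary using (¬_)
open import Relation.Binary.PropositionalEquality using (_≡_)

-- V₁ = Fin n₁, V₂ = Fin n₂ (disjoint as they live in different types).
-- A finite simple undirected graph on Fin n: a symmetric irreflexive Bool-valued adjacency.
record SimpleGraph (n : ℕ) : Set where
  field
    adj   : Fin n → Fin n → Bool
    sym   : ∀ u v → adj u v ≡ adj v u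
    irrefl : ∀ v → adj v v ≡ false
open SimpleGraph public

Bip : ℕ → ℕ → Set
Bip n₁ n₂ = Fin n₁ → Fin n₂ → Bool

allFinL : (n : ℕ) → List (Fin n)
allFinL n = Data.List.tabulate (λ i → i)
  where import Data.List

deg₁ : ∀ {n₁ n₂} → Bip n₁ n₂ → Fin n₁ → ℕ
deg₁ {n₁} {n₂} S i = length (filterᵇ (λ j → S i j) (allFinL n₂))

deg₂ : ∀ {n₁ n₂} → Bip n₁ n₂ → Fin n₂ → ℕ
deg₂ {n₁} {n₂} S j = length (filterᵇ (λ i → S i j) (allFinL n₁))

record Instance (n₁ n₂ m₁ m₂ : ℕ) : Set where
  field
    G₁ : SimpleGraph n₁
    G₂ : SimpleGraph n₂
    S  : Bip n₁ n₂
    deg₁-bound : ∀ i → deg₁ S i ≤ m₁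
    deg₂-bound : ∀ j → deg₂ S j ≤ m₂
open Instance public

Edge : ℕ → ℕ → Set
Edge n₁ n₂ = Fin n₁ × Fin n₂

record C4 {n₁ n₂ m₁ m₂} (I : Instance n₁ n₂ m₁ m₂) : Set where
  constructor c4
  field
    a b : Fin n₁
    c d : Fin n₂
    ab∈E₁ : adj (G₁ I) a b ≡ true
    cd∈E₂ : adj (G₂ I) c d ≡ true
    ad∈S  : S I a d ≡ true
    bc∈S  : S I b c ≡ true
open C4 public

-- c₄s are regarded as subgraphs: a-b-c-d-a and b-a-d-c-a are the same 4-cycle
-- (these are the only two labellings of the required shape).
SameC4 : ∀ {n₁ n₂ m₁ m₂} {I : Instance n₁ n₂ m₁ m₂} → C4 I → C4 I → Set
SameC4 x y =
  (a x ≡ a y × b x ≡ b y × c x ≡ c y × d x ≡ d y)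
  ⊎ (a x ≡ b y × b x ≡ a y × c x ≡ d y × d x ≡ c y)

simEdges : ∀ {n₁ n₂ m₁ m₂} {I : Instance n₁ n₂ m₁ m₂} → C4 I → List (Edge n₁ n₂)
simEdges x = (a x , d x) ∷ (b x , c x) ∷ []

IsMatching : ∀ {n₁ n₂} → List (Edge n₁ n₂) → Set
IsMatching M = ∀ {e e'} → e ∈ M → e' ∈ M →
  (proj₁ e ≡ proj₁ e' ⊎ proj₂ e ≡ proj₂ e') → e ≡ e'

IsMatchingOf : ∀ {n₁ n₂} → Bip n₁ n₂ → List (Edge n₁ n₂) → Set
IsMatchingOf S M = All (λ e → S (proj₁ e) (proj₂ e) ≡ true) M × IsMatching M

Conflict : ∀ {n₁ n₂ m₁ m₂} {I : Instance n₁ n₂ m₁ m₂} → C4 I → C4 I → Set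
Conflict {I = I} x y =
  ¬ (Σ (List (Edge _ _)) λ M → IsMatchingOf (S I) M
       × All (_∈ M) (simEdges x) × All (_∈ M) (simEdges y))

ConflictAdj : ∀ {n₁ n₂ m₁ m₂} {I : Instance n₁ n₂ m₁ m₂} → C4 I → C4 I → Set
ConflictAdj x y = ¬ SameC4 x y × Conflict x y

IsClique : ∀ {n₁ n₂ m₁ m₂} {I : Instance n₁ n₂ m₁ m₂} → List (C4 I) → Set
IsClique K = AllPairs ConflictAdj K

-- Since every vertex of V₂ has S-degree at most 1, two similarity edges can only clash at
-- a vertex of V₁.  Hence a c₄ a-b-c-d-a is faithfully recorded by the partial map
-- a ↦ d, b ↦ c from V₁ to V₂, and two c₄s conflict exactly when their maps disagree at a
-- common point.  Now choose independently, for every vertex v ∈ V₁ with an S-neighbour,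
-- one of its at most m₁ neighbours.  The choices extending the maps of pairwise
-- conflicting c₄s form disjoint sets, and each such set contains at least a 1/m₁² fraction
-- of all choices, since a c₄ fixes the choice at only two vertices.
module Submission where

open import Defs
open import Data.Nat using (ℕ; _≤_; _*_)
open import Data.List using (List; length)

open import Data.Nat using (_+_; _^_; z≤n; s≤s; NonZero; >-nonZero)
open import Data.Nat.Properties
open import Data.Nat.ListAction using (sum; product)
open import Data.Nat.ListAction.Properties using (product≢0)
import Algebra.Properties.CommutativeSemigroup +-commutativeSemigroup as +-CS
import Algebra.Properties.CommutativeSemigroup *-commutativeSemigroup as *-CS
open import Data.Bool using (Bool; true; false; T)
open import Data.Unit using (tt)
open import Data.Fin using (Fin) renaming (_≟_ to _≟ᶠ_)
open import Data.List using ([]; _∷_; _++_; map; filter; filterᵇ)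
open import Data.List.Properties using (filter-accept; filter-reject; filter-all; length-map)
open import Data.List.Membership.Propositional using (_∈_)
open import Data.List.Membership.Propositional.Properties using (∈-map⁺; ∈-map⁻; ∈-filter⁺; ∈-allFin; ∈-++⁻)
import Data.List.Membership.DecPropositional as DecMembership
open import Data.List.Relation.Unary.Any using (here; there)
open import Data.List.Relation.Unary.All using (All; []; _∷_)
import Data.List.Relation.Unary.All as All
import Data.List.Relation.Unary.All.Properties as All
open import Data.List.Relation.Unary.AllPairs using (AllPairs; []; _∷_)
import Data.List.Relation.Unary.AllPairs as AllPairs
import Data.List.Relation.Unary.AllPairs.Properties as AllPairs
open import Data.List.Relation.Unary.Unique.Propositional using (Unique)
import Data.List.Relation.Unary.Unique.Propositional.Properties as Unique
open import Data.Product using (_×_; _,_; proj₁; proj₂)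
open import Data.Product.Properties using (≡-dec)
open import Data.Sum using (_⊎_; inj₁; inj₂)
open import Data.Empty using (⊥-elim)
open import Relation.Nullary using (¬_; Dec; yes; no; ¬?)
open import Relation.Nullary.Decidable using (_⊎-dec_; T?)
open import Relation.Unary using (Decidable)
open import Relation.Binary.Definitions using (DecidableEquality)
open import Relation.Binary.PropositionalEquality
  using (_≡_; _≢_; refl; trans; cong; cong₂; subst; module ≡-Reasoning)
import Relation.Binary.PropositionalEquality as ≡
open import Function using (_∘_)

module _ {X : Set} where

  ∈⇒1≤length : ∀ {x : X} {xs} → x ∈ xs → 1 ≤ length xs
  ∈⇒1≤length {xs = _ ∷ _} _ = s≤s z≤n

  ∈-filterᵇ⁺ : ∀ {p : X → Bool} {x xs} → x ∈ xs → p x ≡ true → x ∈ filterᵇ p xs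
  ∈-filterᵇ⁺ {p} x∈xs px≡true = ∈-filter⁺ (T? ∘ p) x∈xs (subst T (≡.sym px≡true) tt)

  length≤1⇒∈-unique : ∀ {xs : List X} {x y} → length xs ≤ 1 → x ∈ xs → y ∈ xs → x ≡ y
  length≤1⇒∈-unique {_ ∷ []}    _        (here refl) (here refl) = refl
  length≤1⇒∈-unique {_ ∷ _ ∷ _} (s≤s ()) _           _

  Unique∧All≡⇒length≤1 : ∀ {c : X} {xs} → Unique xs → All (_≡ c) xs → length xs ≤ 1
  Unique∧All≡⇒length≤1 []                  _                = z≤n
  Unique∧All≡⇒length≤1 (_ ∷ [])            _                = s≤s z≤n
  Unique∧All≡⇒length≤1 ((x≢y ∷ _) ∷ _ ∷ _) (x≡c ∷ y≡c ∷ _) = ⊥-elim (x≢y (trans x≡c (≡.sym y≡c)))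

  Unique∧All∈pair⇒length≤2 : ∀ {a b : X} {xs} → Unique xs → All (_∈ a ∷ b ∷ []) xs → length xs ≤ 2
  Unique∧All∈pair⇒length≤2 [] [] = z≤n
  Unique∧All∈pair⇒length≤2 (x≢xs ∷ unique) (here refl ∷ xs∈ab) =
    s≤s (Unique∧All≡⇒length≤1 unique (All.zipWith ≢first⇒≡second (x≢xs , xs∈ab)))
    where
    ≢first⇒≡second : ∀ {a b y : X} → a ≢ y × y ∈ a ∷ b ∷ [] → y ≡ b
    ≢first⇒≡second (a≢a , here refl)        = ⊥-elim (a≢a refl)
    ≢first⇒≡second (_   , there (here refl)) = refl
  Unique∧All∈pair⇒length≤2 (x≢xs ∷ unique) (there (here refl) ∷ xs∈ab) =
    s≤s (Unique∧All≡⇒length≤1 unique (All.zipWith ≢second⇒≡first (x≢xs , xs∈ab)))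
    where
    ≢second⇒≡first : ∀ {a b y : X} → b ≢ y × y ∈ a ∷ b ∷ [] → y ≡ a
    ≢second⇒≡first (_   , here refl)         = refl
    ≢second⇒≡first (b≢b , there (here refl)) = ⊥-elim (b≢b refl)

  AllPairs-mapWithAll : ∀ {P : X → Set} {R R′ : X → X → Set} {xs} → All P xs → AllPairs R xs →
    (∀ {x y} → P x → P y → R x y → R′ x y) → AllPairs R′ xs
  AllPairs-mapWithAll []       []         _ = []
  AllPairs-mapWithAll (p ∷ ps) (rs ∷ rss) h =
    All.zipWith (λ (q , r) → h p q r) (ps , rs) ∷ AllPairs-mapWithAll ps rss h

  sum-map-mono : ∀ {f g : X → ℕ} {xs} → All (λ x → f x ≤ g x) xs → sum (map f xs) ≤ sum (map g xs)
  sum-map-mono []            = z≤n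
  sum-map-mono (fx≤gx ∷ f≤g) = +-mono-≤ fx≤gx (sum-map-mono f≤g)

  sum-map≤length* : ∀ {c} (f : X → ℕ) xs → (∀ x → f x ≤ c) → sum (map f xs) ≤ length xs * c
  sum-map≤length* f []       _   = z≤n
  sum-map≤length* f (x ∷ xs) f≤c = +-mono-≤ (f≤c x) (sum-map≤length* f xs f≤c)

  length*≤*sum-map : ∀ {c} k (f : X → ℕ) {xs} → All (λ x → c ≤ k * f x) xs →
    length xs * c ≤ k * sum (map f xs)
  length*≤*sum-map k f {[]}     []             = z≤n
  length*≤*sum-map k f {x ∷ xs} (c≤kfx ∷ c≤kf) = begin
    _                             ≤⟨ +-mono-≤ c≤kfx (length*≤*sum-map k f c≤kf) ⟩
    k * f x + k * sum (map f xs)  ≡⟨ *-distribˡ-+ k (f x) _ ⟨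
    k * sum (map f (x ∷ xs))      ∎
    where open ≤-Reasoning

module _ {X Y : Set} {R : X → Y → Set} (R? : ∀ x y → Dec (R x y)) (g : Y → ℕ) where

  sum-filter-comm : ∀ xs ys →
    sum (map (λ x → sum (map g (filter (R? x) ys))) xs)
      ≡ sum (map (λ y → length (filter (λ x → R? x y) xs) * g y) ys)
  sum-filter-comm xs []       = sum-zeros xs
    where
    sum-zeros : ∀ xs → sum (map (λ _ → 0) xs) ≡ 0
    sum-zeros []       = refl
    sum-zeros (_ ∷ xs) = sum-zeros xs
  sum-filter-comm xs (y ∷ ys) = trans (split-head xs) (cong (_ +_) (sum-filter-comm xs ys))
    where
    open ≡-Reasoning
    whole rest : X → ℕ
    whole x = sum (map g (filter (R? x) (y ∷ ys)))
    rest x = sum (map g (filter (R? x) ys))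
    split-head : ∀ xs → sum (map whole xs) ≡ length (filter (λ x → R? x y) xs) * g y + sum (map rest xs)
    split-head []       = refl
    split-head (x ∷ xs) = by-cases (R? x y)
      where
      n r : ℕ
      n = length (filter (λ x → R? x y) xs)
      r = sum (map rest xs)
      by-cases : Dec (R x y) → whole x + sum (map whole xs)
        ≡ length (filter (λ x → R? x y) (x ∷ xs)) * g y + (rest x + r)
      by-cases (yes Rxy) = begin
        whole x + sum (map whole xs)
          ≡⟨ cong₂ _+_ (cong (sum ∘ map g) (filter-accept (R? x) Rxy)) (split-head xs) ⟩
        (g y + rest x) + (n * g y + r)
          ≡⟨ +-CS.interchange (g y) (rest x) (n * g y) r ⟩
        (g y + n * g y) + (rest x + r)
          ≡⟨ cong (λ l → length l * g y + (rest x + r)) (filter-accept (λ x → R? x y) Rxy) ⟨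
        length (filter (λ x → R? x y) (x ∷ xs)) * g y + (rest x + r) ∎
      by-cases (no ¬Rxy) = begin
        whole x + sum (map whole xs)
          ≡⟨ cong₂ _+_ (cong (sum ∘ map g) (filter-reject (R? x) ¬Rxy)) (split-head xs) ⟩
        rest x + (n * g y + r)
          ≡⟨ +-CS.x∙yz≈y∙xz (rest x) (n * g y) r ⟩
        n * g y + (rest x + r)
          ≡⟨ cong (λ l → length l * g y + (rest x + r)) (filter-reject (λ x → R? x y) ¬Rxy) ⟨
        length (filter (λ x → R? x y) (x ∷ xs)) * g y + (rest x + r) ∎

-- Partial choice functions for the family A, each given as the list of its graph.
module PartialChoices {V B : Set} (_≟ⱽ_ : DecidableEquality V) (_≟ᴮ_ : DecidableEquality B)
                      (A : V → List B) where

  open DecMembership _≟ⱽ_ using () renaming (_∈?_ to _∈ⱽ?_)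
  open DecMembership (≡-dec _≟ⱽ_ _≟ᴮ_) using () renaming (_∈?_ to _∈ᴾ?_)

  Assignment : Set
  Assignment = List (V × B)

  size : V → ℕ
  size v = length (A v)

  volume : List V → ℕ
  volume vs = product (map size vs)

  _∈dom_ : V → Assignment → Set
  v ∈dom f = v ∈ map proj₁ f

  _∈dom?_ : ∀ v f → Dec (v ∈dom f)
  v ∈dom? f = v ∈ⱽ? map proj₁ f

  -- The number of choice functions on vs extending f.
  weight : List V → Assignment → ℕ
  weight vs f = volume (filter (λ v → ¬? (v ∈dom? f)) vs)

  domSize : List V → Assignment → ℕ
  domSize vs f = length (filter (_∈dom? f) vs)

  Functional : Assignment → Set
  Functional f = ∀ {v β β′} → (v , β) ∈ f → (v , β′) ∈ f → β ≡ β′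

  FunctionalOn : List V → Assignment → Set
  FunctionalOn vs f = ∀ {v β β′} → v ∈ vs → (v , β) ∈ f → (v , β′) ∈ f → β ≡ β′

  Admissible : Assignment → Set
  Admissible f = ∀ {v β} → (v , β) ∈ f → β ∈ A v

  Clash : List V → Assignment → Assignment → Set
  Clash vs f g = ¬ FunctionalOn vs (f ++ g)

  Allows : V → B → Assignment → Set
  Allows v β f = (v , β) ∈ f ⊎ ¬ v ∈dom f

  allows? : ∀ v β → Decidable (Allows v β)
  allows? v β f = ((v , β) ∈ᴾ? f) ⊎-dec ¬? (v ∈dom? f)

  allows⇒value : ∀ {v β β′ f} → Functional f → Allows v β f → (v , β′) ∈ f → β′ ≡ β
  allows⇒value fun (inj₁ vβ∈f)  vβ′∈f = fun vβ′∈f vβ∈f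
  allows⇒value fun (inj₂ v∉dom) vβ′∈f = ⊥-elim (v∉dom (∈-map⁺ proj₁ vβ′∈f))

  Clash-tail : ∀ {v vs β f g} → Functional f → Functional g → Allows v β f → Allows v β g →
    Clash (v ∷ vs) f g → Clash vs f g
  Clash-tail {v} {vs} {β} {f} {g} fun-f fun-g f-allows g-allows clash fun-vs = clash fun-v∷vs
    where
    value-at-v : ∀ {β′} → (v , β′) ∈ f ++ g → β′ ≡ β
    value-at-v vβ′∈ with ∈-++⁻ f vβ′∈
    ... | inj₁ vβ′∈f = allows⇒value fun-f f-allows vβ′∈f
    ... | inj₂ vβ′∈g = allows⇒value fun-g g-allows vβ′∈g
    fun-v∷vs : FunctionalOn (v ∷ vs) (f ++ g)
    fun-v∷vs (here refl) vβ∈ vβ′∈ = trans (value-at-v vβ∈) (≡.sym (value-at-v vβ′∈))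
    fun-v∷vs (there u∈vs) = fun-vs u∈vs

  pair-functional : ∀ {u u′ β β′} → u ≢ u′ → Functional ((u , β) ∷ (u′ , β′) ∷ [])
  pair-functional u≢u′ (here refl)         (here refl)         = refl
  pair-functional u≢u′ (here refl)         (there (here refl)) = ⊥-elim (u≢u′ refl)
  pair-functional u≢u′ (there (here refl)) (here refl)         = ⊥-elim (u≢u′ refl)
  pair-functional u≢u′ (there (here refl)) (there (here refl)) = refl

  domSize-pair≤2 : ∀ {vs u u′ β β′} → Unique vs → domSize vs ((u , β) ∷ (u′ , β′) ∷ []) ≤ 2
  domSize-pair≤2 {vs} {u} {u′} {β} {β′} unique = Unique∧All∈pair⇒length≤2
    (Unique.filter⁺ (_∈dom? f) unique) (All.all-filter (_∈dom? f) vs)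
    where
    f : Assignment
    f = (u , β) ∷ (u′ , β′) ∷ []

  weight-∷-∈dom : ∀ {v} vs {f} → v ∈dom f → weight (v ∷ vs) f ≡ weight vs f
  weight-∷-∈dom vs {f} v∈dom =
    cong volume (filter-reject (λ v → ¬? (v ∈dom? f)) (λ v∉dom → v∉dom v∈dom))

  weight-∷-∉dom : ∀ {v} vs {f} → ¬ v ∈dom f → weight (v ∷ vs) f ≡ size v * weight vs f
  weight-∷-∉dom vs {f} v∉dom = cong volume (filter-accept (λ v → ¬? (v ∈dom? f)) v∉dom)

  domSize-∷-∈dom : ∀ {v} vs {f} → v ∈dom f → domSize (v ∷ vs) f ≡ 1 + domSize vs f
  domSize-∷-∈dom vs {f} v∈dom = cong length (filter-accept (_∈dom? f) v∈dom)

  domSize-∷-∉dom : ∀ {v} vs {f} → ¬ v ∈dom f → domSize (v ∷ vs) f ≡ domSize vs f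
  domSize-∷-∉dom vs {f} v∉dom = cong length (filter-reject (_∈dom? f) v∉dom)

  weight-∷-≤ : ∀ {v} vs {f} → Admissible f →
    weight (v ∷ vs) f ≤ length (filter (λ β → allows? v β f) (A v)) * weight vs f
  weight-∷-≤ {v} vs {f} admissible = by-cases (v ∈dom? f)
    where
    open ≤-Reasoning
    allowed : List B
    allowed = filter (λ β → allows? v β f) (A v)
    by-cases : Dec (v ∈dom f) → weight (v ∷ vs) f ≤ length allowed * weight vs f
    by-cases (yes v∈dom) with (_ , β) , vβ∈f , refl ← ∈-map⁻ proj₁ v∈dom = begin
      weight (v ∷ vs) f  ≡⟨ weight-∷-∈dom vs v∈dom ⟩
      weight vs f        ≡⟨ *-identityˡ (weight vs f) ⟨
      1 * weight vs f    ≤⟨ *-monoˡ-≤ (weight vs f) (∈⇒1≤length β∈allowed) ⟩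
      length allowed * weight vs f ∎
      where
      β∈allowed : β ∈ allowed
      β∈allowed = ∈-filter⁺ (λ β → allows? v β f) (admissible vβ∈f) (inj₁ vβ∈f)
    by-cases (no v∉dom) = begin
      weight (v ∷ vs) f            ≡⟨ weight-∷-∉dom vs v∉dom ⟩
      length (A v) * weight vs f   ≡⟨ cong (λ l → length l * weight vs f) everything-allowed ⟨
      length allowed * weight vs f ∎
      where
      everything-allowed : allowed ≡ A v
      everything-allowed = filter-all (λ β → allows? v β f) (All.universal (λ _ → inj₂ v∉dom) (A v))

  sum-weight≤volume : ∀ vs (F : List Assignment) → All Functional F → All Admissible F →
    AllPairs (Clash vs) F → sum (map (weight vs) F) ≤ volume vs
  sum-weight≤volume [] []          _ _ _                 = z≤n
  sum-weight≤volume [] (_ ∷ [])    _ _ _                 = ≤-refl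
  sum-weight≤volume [] (_ ∷ _ ∷ _) _ _ ((clash ∷ _) ∷ _) = ⊥-elim (clash λ ())
  sum-weight≤volume (v ∷ vs) F functional admissible clashes = begin
    sum (map (weight (v ∷ vs)) F)
      ≤⟨ sum-map-mono (All.map (weight-∷-≤ vs) admissible) ⟩
    sum (map (λ f → length (filter (λ β → allows? v β f) (A v)) * weight vs f) F)
      ≡⟨ sum-filter-comm (allows? v) (weight vs) (A v) F ⟨
    sum (map (λ β → sum (map (weight vs) (filter (allows? v β) F))) (A v))
      ≤⟨ sum-map≤length* _ (A v) bound-for-value ⟩
    size v * volume vs ∎
    where
    open ≤-Reasoning
    -- The assignments allowing v ↦ β still clash pairwise, now away from v.
    bound-for-value : ∀ β → sum (map (weight vs) (filter (allows? v β) F)) ≤ volume vs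
    bound-for-value β = sum-weight≤volume vs (filter (allows? v β) F)
      (All.filter⁺ (allows? v β) functional)
      (All.filter⁺ (allows? v β) admissible)
      (AllPairs-mapWithAll functional∧allows (AllPairs.filter⁺ (allows? v β) clashes)
        (λ (fun-f , f-allows) (fun-g , g-allows) → Clash-tail fun-f fun-g f-allows g-allows))
      where
      functional∧allows : All (λ f → Functional f × Allows v β f) (filter (allows? v β) F)
      functional∧allows =
        All.zip (All.filter⁺ (allows? v β) functional , All.all-filter (allows? v β) F)

  volume≤^domSize*weight : ∀ {m} → (∀ v → size v ≤ m) → ∀ vs f →
    volume vs ≤ m ^ domSize vs f * weight vs f
  volume≤^domSize*weight size≤m []       f = ≤-refl
  volume≤^domSize*weight {m} size≤m (v ∷ vs) f = by-cases (v ∈dom? f)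
    where
    open ≤-Reasoning
    k w : ℕ
    k = domSize vs f
    w = weight vs f
    IH : volume vs ≤ m ^ k * w
    IH = volume≤^domSize*weight size≤m vs f
    by-cases : Dec (v ∈dom f) → volume (v ∷ vs) ≤ m ^ domSize (v ∷ vs) f * weight (v ∷ vs) f
    by-cases (yes v∈dom) = begin
      size v * volume vs                 ≤⟨ *-mono-≤ (size≤m v) IH ⟩
      m * (m ^ k * w)                    ≡⟨ *-assoc m _ _ ⟨
      m ^ (1 + k) * w
        ≡⟨ cong₂ (λ k′ w′ → m ^ k′ * w′) (domSize-∷-∈dom vs v∈dom) (weight-∷-∈dom vs v∈dom) ⟨
      m ^ domSize (v ∷ vs) f * weight (v ∷ vs) f ∎
    by-cases (no v∉dom) = begin
      size v * volume vs                 ≤⟨ *-monoʳ-≤ (size v) IH ⟩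
      size v * (m ^ k * w)               ≡⟨ *-CS.x∙yz≈y∙xz (size v) (m ^ k) w ⟩
      m ^ k * (size v * w)
        ≡⟨ cong₂ (λ k′ w′ → m ^ k′ * w′) (domSize-∷-∉dom vs v∉dom) (weight-∷-∉dom vs v∉dom) ⟨
      m ^ domSize (v ∷ vs) f * weight (v ∷ vs) f ∎

module ConflictCliques {n₁ n₂ m₁ : ℕ} (I : Instance n₁ n₂ m₁ 1) where

  neighbours : Fin n₁ → List (Fin n₂)
  neighbours u = filterᵇ (S I u) (allFinL n₂)

  open PartialChoices _≟ᶠ_ _≟ᶠ_ neighbours public

  hasNeighbour? : ∀ u → Dec (1 ≤ size u)
  hasNeighbour? u = 1 ≤? size u

  covered : List (Fin n₁)
  covered = filter hasNeighbour? (allFinL n₁)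

  volume-covered-nonZero : NonZero (volume covered)
  volume-covered-nonZero =
    product≢0 (All.map⁺ (All.map >-nonZero (All.all-filter hasNeighbour? (allFinL n₁))))

  S⇒∈neighbours : ∀ {u j} → S I u j ≡ true → j ∈ neighbours u
  S⇒∈neighbours {j = j} = ∈-filterᵇ⁺ (∈-allFin j)

  S⇒∈covered : ∀ {u j} → S I u j ≡ true → u ∈ covered
  S⇒∈covered {u} uj∈S =
    ∈-filter⁺ hasNeighbour? (∈-allFin u) (∈⇒1≤length (S⇒∈neighbours uj∈S))

  -- This is where m₂ = 1 enters.
  S-injective : ∀ {u u′ j} → S I u j ≡ true → S I u′ j ≡ true → u ≡ u′
  S-injective {u} {u′} {j} uj∈S u′j∈S = length≤1⇒∈-unique (deg₂-bound I j)
    (∈-filterᵇ⁺ (∈-allFin u) uj∈S) (∈-filterᵇ⁺ (∈-allFin u′) u′j∈S)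

  a≢b : (x : C4 I) → a x ≢ b x
  a≢b x a≡b = true≢false (begin
    true                      ≡⟨ ab∈E₁ x ⟨
    adj (G₁ I) (a x) (b x)    ≡⟨ cong (adj (G₁ I) (a x)) a≡b ⟨
    adj (G₁ I) (a x) (a x)    ≡⟨ irrefl (G₁ I) (a x) ⟩
    false                     ∎)
    where
    open ≡-Reasoning
    true≢false : true ≢ false
    true≢false ()

  simEdges-functional : (x : C4 I) → Functional (simEdges x)
  simEdges-functional x = pair-functional (a≢b x)

  simEdges-admissible : (x : C4 I) → Admissible (simEdges x)
  simEdges-admissible x (here refl)         = S⇒∈neighbours (ad∈S x)
  simEdges-admissible x (there (here refl)) = S⇒∈neighbours (bc∈S x)

  conflict⇒clash : ∀ {x y : C4 I} → Conflict x y → Clash covered (simEdges x) (simEdges y)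
  conflict⇒clash {x} {y} conflict functional =
    conflict (M , (M⊆S , M-matching) , here refl ∷ there (here refl) ∷ [] ,
              there (there (here refl)) ∷ there (there (there (here refl))) ∷ [])
    where
    M : List (Edge n₁ n₂)
    M = simEdges x ++ simEdges y
    M⊆S : All (λ e → S I (proj₁ e) (proj₂ e) ≡ true) M
    M⊆S = ad∈S x ∷ bc∈S x ∷ ad∈S y ∷ bc∈S y ∷ []
    M-matching : IsMatching M
    M-matching {u , j} e∈M e′∈M (inj₁ refl) =
      cong (u ,_) (functional (S⇒∈covered (All.lookup M⊆S e∈M)) e∈M e′∈M)
    M-matching {u , j} e∈M e′∈M (inj₂ refl) =
      cong (_, j) (S-injective (All.lookup M⊆S e∈M) (All.lookup M⊆S e′∈M))

  clique⇒clashes : ∀ {K : List (C4 I)} → IsClique K → AllPairs (Clash covered) (map simEdges K)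
  clique⇒clashes clique =
    AllPairs.map⁺ (AllPairs.map (λ {x} {y} (_ , conflict) → conflict⇒clash {x} {y} conflict) clique)

  domSize-simEdges≤2 : (x : C4 I) → domSize covered (simEdges x) ≤ 2
  domSize-simEdges≤2 x = domSize-pair≤2 {u = a x} {b x} {d x} {c x}
    (Unique.filter⁺ hasNeighbour? (Unique.allFin⁺ n₁))

  volume≤m₁²*weight : .{{NonZero m₁}} → (x : C4 I) →
    volume covered ≤ m₁ * m₁ * weight covered (simEdges x)
  volume≤m₁²*weight x = begin
    volume covered
      ≤⟨ volume≤^domSize*weight (deg₁-bound I) covered (simEdges x) ⟩
    m₁ ^ domSize covered (simEdges x) * w
      ≤⟨ *-monoˡ-≤ w (^-monoʳ-≤ m₁ (domSize-simEdges≤2 x)) ⟩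
    m₁ ^ 2 * w
      ≡⟨ cong (λ k → m₁ * k * w) (*-identityʳ m₁) ⟩
    m₁ * m₁ * w ∎
    where
    open ≤-Reasoning
    w : ℕ
    w = weight covered (simEdges x)

theorem12 : ∀ {n₁ n₂ m₁ : ℕ} → 1 ≤ m₁ → (I : Instance n₁ n₂ m₁ 1) →
    (K : List (C4 I)) → IsClique K → length K ≤ m₁ * m₁
theorem12 {m₁ = m₁} 1≤m₁ I K clique =
  *-cancelʳ-≤ (length K) (m₁ * m₁) (volume covered) {{volume-covered-nonZero}} (begin
    length K * volume covered
      ≡⟨ cong (_* volume covered) (length-map simEdges K) ⟨
    length F * volume covered
      ≤⟨ length*≤*sum-map (m₁ * m₁) (weight covered) (All.map⁺ (All.universal volume≤m₁²*weight K)) ⟩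
    m₁ * m₁ * sum (map (weight covered) F)
      ≤⟨ *-monoʳ-≤ (m₁ * m₁) (sum-weight≤volume covered F
           (All.map⁺ (All.universal simEdges-functional K))
           (All.map⁺ (All.universal simEdges-admissible K))
           (clique⇒clashes clique)) ⟩
    m₁ * m₁ * volume covered ∎)
  where
  open ConflictCliques I
  open ≤-Reasoning
  instance
    m₁-nonZero : NonZero m₁
    m₁-nonZero = >-nonZero 1≤m₁
  F : List Assignment
  F = map simEdges K
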